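{- Let $p$ be a prime and let $L=\{l_1,\ldots,l_s\}$ and $K=\{k_1,\ldots,k_r\}$ be disjoint subsets of $\{0,1,\ldots,p-1\}$. Let $\mathcal{A}=\{A_1,\ldots,A_m\}$ be a family of subsets of $[n]$ such that $|A_i|\pmod p\in K$ for every $i$ and $|A_i\cap A_j|\pmod p\in L$ for all $i\neq j$. Let $X=[n-1]$, and for each $I\subseteq X$ define the linear form $L_I=\sum_{i:\, I\subseteq A_i} x_i$ in the variables $x_1,\ldots,x_m$ over $\mathbb{F}_p$. Then for any $i\in\{0,1,\ldots,s-2r+1\}$, \[ \langle L_H: H\subseteq X,\ i\le |H|\le i+2r-1\rangle=\langle L_H: H\subseteq X,\ i\le |H|\le i+2r-1\rangle+\Big\langle\sum_{H\subseteq X,\ |H|=i+2r,\ I\subseteq H}L_H : I\subseteq X,\ |I|=i\Big\rangle, \] where $\langle S\rangle$ denotes the $\mathbb{F}_p$-linear span of a set $S$ of linear forms. -}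

module Defs where

open import Data.Bool using (Bool; true; false; if_then_else_)
open import Data.Nat as ℕ using (ℕ; zero; suc; _%_; _∸_)
open import Data.Nat.Primality using (Prime; prime⇒nonZero)
open import Data.Integer as ℤ using (ℤ; +_; _+_; _*_; _-_)
open import Data.Integer.Divisibility using (_∣_)
open import Data.Fin using (Fin; toℕ)
open import Data.Fin.Subset using (Subset; _∈_; _⊆_; ∣_∣; inside; outside)
open import Data.Fin.Subset.Properties using (_⊆?_)
open import Data.List using (List; []; _∷_; map; foldr; _++_)
open import Data.List.Relation.Unary.All using (All)
open import Data.Vec using (tabulate; _∷_; [])
open import Data.Product using (Σ; ∃; ∃-syntax; _×_; _,_; proj₁; proj₂)
open import Relation.Nullary.Decidable using (⌊_⌋)
open import Relation.Binary.PropositionalEquality using (_≡_)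

ResidueIn : (p : ℕ) → Prime p → Subset p → ℕ → Set
ResidueIn p pp K a = ∃[ k ] (k ∈ K × toℕ k ≡ a % p)
  where instance _ = prime⇒nonZero pp

-- X = [n-1] viewed as a subset of [n] = Fin n (the first n-1 elements)
Xset : (n : ℕ) → Subset n
Xset n = tabulate (λ j → ⌊ suc (toℕ j) ℕ.≤? n ∸ 1 ⌋)

-- linear forms in x_1,…,x_m : coefficient vectors (integer representatives
-- of elements of F_p)
Form : ℕ → Set
Form m = Fin m → ℤ

_≈[_]_ : ∀ {m} → Form m → ℕ → Form m → Set
v ≈[ p ] w = ∀ k → (+ p) ∣ (v k - w k)

zeroF : ∀ {m} → Form m
zeroF _ = + 0

_⊕_ : ∀ {m} → Form m → Form m → Form m
(v ⊕ w) k = v k + w k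

_⊙_ : ∀ {m} → ℤ → Form m → Form m
(c ⊙ v) k = c * v k

LForm : ∀ {n m} → (Fin m → Subset n) → Subset n → Form m
LForm A I k = if ⌊ I ⊆? A k ⌋ then + 1 else + 0

allSubsets : (n : ℕ) → List (Subset n)
allSubsets zero = [] ∷ []
allSubsets (suc n) = map (inside ∷_) (allSubsets n) ++ map (outside ∷_) (allSubsets n)

sumForms : ∀ {m} → List (Form m) → Form m
sumForms = foldr _⊕_ zeroF

InSpan : ∀ {m} → (p : ℕ) → (Form m → Set) → Form m → Set
InSpan {m} p S v =
  ∃[ cs ] (All (λ cg → S (proj₂ cg)) cs ×
           v ≈[ p ] sumForms (map (λ (cg : ℤ × Form m) → proj₁ cg ⊙ proj₂ cg) cs))

InSum : ∀ {m} → (p : ℕ) → (Form m → Set) → (Form m → Set) → Form m → Set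
InSum p U W v = ∃[ a ] ∃[ b ] (U a × W b × v ≈[ p ] (a ⊕ b))

open import Data.Bool using (_∧_)
open import Data.List using (filterᵇ)
open import Data.Nat using (_≤_; _≡ᵇ_)

LowGen : ∀ {n m} → (p : ℕ) → (Fin m → Subset n) → (i r : ℕ) → Form m → Set
LowGen {n} p A i r g =
  ∃[ H ] (H ⊆ Xset n × i ≤ ∣ H ∣ × suc ∣ H ∣ ≤ i ℕ.+ 2 ℕ.* r × g ≈[ p ] LForm A H)

HighSum : ∀ {n m} → (Fin m → Subset n) → (i r : ℕ) → Subset n → Form m
HighSum {n} A i r I =
  sumForms (map (LForm A)
    (filterᵇ (λ H → ⌊ H ⊆? Xset n ⌋ ∧ (∣ H ∣ ≡ᵇ i ℕ.+ 2 ℕ.* r) ∧ ⌊ I ⊆? H ⌋)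
             (allSubsets n)))

HighGen : ∀ {n m} → (p : ℕ) → (Fin m → Subset n) → (i r : ℕ) → Form m → Set
HighGen {n} p A i r g =
  ∃[ I ] (I ⊆ Xset n × ∣ I ∣ ≡ i × g ≈[ p ] HighSum A i r I)

-- Fix I ⊆ X with |I| = i and write r = |K|.  At the variable x_a, the sum of the L_H over
-- {H : I ⊆ H ⊆ X, |H| = i + j} counts the sets between I and X ∩ A_a of that size, that is
-- C(u, j) with u = |X ∩ A_a| - i (and 0 when I ⊈ A_a).  As |A_a| = u + i + [n ∈ A_a] ≡ k (mod p)
-- for some k ∈ K, u is a root of P(x) = ∏_{k ∈ K} (x - (k - i)) (x - (k - i - 1)), a monic
-- polynomial of degree 2r.  Expanding P = Σ_{j ≤ 2r} D_j C(x, j) in the binomial basis gives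
-- D_{2r} = (2r)!, a unit mod p when 2r < p, so C(u, 2r) is one fixed combination of the C(u, j),
-- j < 2r, for every a: each high generator lies in the span of the low ones.  Since |K| + |L| ≤ p,
-- the hypothesis i + 2r ≤ |L| + 1 forces 2r < p except for p = 2, r = 1, i = 0; then
-- |A_a ∩ A_b| ≡ 1 - |A_b| (mod 2) for a ≠ b, and L_∅ together with the L_{x}, x ∈ X, already span
-- all of F_2^m.

module Submission where

open import Defs
open import Data.Bool using (Bool; true; false; _∧_; if_then_else_; T)
open import Data.Bool.Properties using (T-∧; ∧-identityʳ; ∧-zeroʳ)
open import Data.Nat as ℕ using (ℕ; zero; suc; _∸_; _≤_; _<_; z≤n; s≤s; _≡ᵇ_; _!)
import Data.Nat.Properties as ℕ
open import Data.Nat.Combinatorics using (_C_; nC1≡n; nCk+nC[k+1]≡[n+1]C[k+1])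
open import Data.Nat.Divisibility using (_∤_; ∣⇒≤; ∣1⇒≡1)
open import Data.Nat.DivMod using (_%_; _/_; m≡m%n+[m/n]*n)
open import Data.Nat.Primality
  using (Prime; prime⇒nonZero; prime⇒nonTrivial; prime⇒irreducible; euclidsLemma)
open import Data.Nat.Coprimality using (Coprime; coprime-Bézout)
open import Data.Nat.GCD using (module Bézout)
open import Data.Integer as ℤ using (ℤ; +_; 0ℤ; 1ℤ; _+_; _*_; _-_; -_)
import Data.Integer.Properties as ℤ
open import Algebra.Definitions.RawMonoid ℤ.+-0-rawMonoid using (sum)
open import Data.Integer.Divisibility.Signed as ℤ∣ using (divides; ∣ᵤ⇒∣; ∣⇒∣ᵤ)
open import Data.Integer.Tactic.RingSolver using (solve-∀)
open import Data.Nat.Tactic.RingSolver using () renaming (solve-∀ to ℕ-solve-∀)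
open import Data.List using (List; []; _∷_; _++_; map; filterᵇ; length)
open import Data.List.Properties using (length-map)
open import Data.List.Membership.Propositional using () renaming (_∈_ to _∈ˡ_)
open import Data.List.Membership.Propositional.Properties using (∈-map⁺)
open import Data.List.Relation.Unary.Any using (here; there)
open import Data.List.Relation.Unary.All as All using (All; []; _∷_)
open import Data.List.Relation.Unary.All.Properties using (all-filter)
import Data.List.Relation.Unary.All.Properties as All
open import Data.Fin using (Fin; zero; suc; toℕ; _≟_)
open import Data.Fin.Subset using (Subset; inside; outside; ⊥; ∁; _⊆_; _∩_; _∈_; ∣_∣; Empty)
open import Data.Fin.Subset.Properties
  using (_⊆?_; ⊆-trans; drop-∷-⊆; p⊆q⇒∣p∣≤∣q∣; p∩q⊆p; p∩q⊆q; x∈p∩q⁺; ⊥⊆; ∣⊥∣≡0; ∩-assoc; ∩-idem;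
         ∣p∣≤n; ∣∁p∣≡n∸∣p∣; x∉p⇒x∈∁p)
open import Data.Vec using ([]; _∷_; here; there)
open import Data.Vec.Properties using (tabulate-cong)
open import Data.Sum using (inj₁; inj₂)
open import Data.Product using (∃-syntax; _×_; _,_; proj₁; proj₂)
open import Relation.Binary.Bundles using (Setoid)
import Relation.Binary.Reasoning.Setoid as ≈-Reasoning
open import Relation.Binary.PropositionalEquality
open import Relation.Nullary using (¬_; contradiction)
open import Relation.Nullary.Decidable
  using (yes; no; ⌊_⌋; T?; does; _×-dec_; ⌊⌋-map′; isYes≗does; does-⇔; toWitness)
open import Function using (id; _∘_; case_of_; Equivalence; _⇔_; mk⇔)

-- Congruences and spans

infix 4 _≡_[mod_]

-- a record rather than a synonym for divisibility, so that x and y can be inferred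
record _≡_[mod_] (x y : ℤ) (p : ℕ) : Set where
  constructor congruent
  field p∣x-y : + p ℤ∣.∣ x - y

open _≡_[mod_]

≡⇒≡-mod : ∀ {p x y} → x ≡ y → x ≡ y [mod p ]
≡⇒≡-mod {x = x} refl = congruent (divides 0ℤ (ℤ.+-inverseʳ x))

≡-mod-sym : ∀ {p x y} → x ≡ y [mod p ] → y ≡ x [mod p ]
≡-mod-sym {x = x} {y} (congruent p∣x-y) =
  congruent (subst (_ ℤ∣.∣_) (negate-difference x y) (ℤ∣.∣m⇒∣-m p∣x-y))
  where
  negate-difference : ∀ x y → - (x - y) ≡ y - x
  negate-difference = solve-∀

≡-mod-trans : ∀ {p x y z} → x ≡ y [mod p ] → y ≡ z [mod p ] → x ≡ z [mod p ]
≡-mod-trans {x = x} {y} {z} (congruent p∣x-y) (congruent p∣y-z) =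
  congruent (subst (_ ℤ∣.∣_) (telescope x y z) (ℤ∣.∣m∣n⇒∣m+n p∣x-y p∣y-z))
  where
  telescope : ∀ x y z → (x - y) + (y - z) ≡ x - z
  telescope = solve-∀

+-cong-mod : ∀ {p a b c d} → a ≡ b [mod p ] → c ≡ d [mod p ] → a + c ≡ b + d [mod p ]
+-cong-mod {a = a} {b} {c} {d} (congruent p∣a-b) (congruent p∣c-d) =
  congruent (subst (_ ℤ∣.∣_) (regroup a b c d) (ℤ∣.∣m∣n⇒∣m+n p∣a-b p∣c-d))
  where
  regroup : ∀ a b c d → (a - b) + (c - d) ≡ (a + c) - (b + d)
  regroup = solve-∀

*-congˡ-mod : ∀ {p a b} c → a ≡ b [mod p ] → c * a ≡ c * b [mod p ]
*-congˡ-mod {a = a} {b} c (congruent p∣a-b) =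
  congruent (subst (_ ℤ∣.∣_) (distribute c a b) (ℤ∣.∣n⇒∣m*n c p∣a-b))
  where
  distribute : ∀ c a b → c * (a - b) ≡ c * a - c * b
  distribute = solve-∀

≡-mod-setoid : ℕ → Setoid _ _
≡-mod-setoid p = record
  { Carrier = ℤ
  ; _≈_ = _≡_[mod p ]
  ; isEquivalence = record { refl = ≡⇒≡-mod refl ; sym = ≡-mod-sym ; trans = ≡-mod-trans }
  }

≈-pointwise : ∀ {m p} {v w : Form m} → (∀ k → v k ≡ w k [mod p ]) → v ≈[ p ] w
≈-pointwise v≡w k = ∣⇒∣ᵤ (p∣x-y (v≡w k))

≈-at : ∀ {m p} {v w : Form m} → v ≈[ p ] w → ∀ k → v k ≡ w k [mod p ]
≈-at v≈w k = congruent (∣ᵤ⇒∣ (v≈w k))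

≈-refl : ∀ {m p} (v : Form m) → v ≈[ p ] v
≈-refl v = ≈-pointwise {v = v} (λ _ → ≡⇒≡-mod refl)

combination : ∀ {m} → List (ℤ × Form m) → Form m
combination {m} = sumForms ∘ map (λ (cg : ℤ × Form m) → proj₁ cg ⊙ proj₂ cg)

combination-++ : ∀ {m} (cs ds : List (ℤ × Form m)) k →
                 combination (cs ++ ds) k ≡ combination cs k + combination ds k
combination-++ [] ds k = sym (ℤ.+-identityˡ _)
combination-++ ((c , g) ∷ cs) ds k =
  trans (cong (λ z → c * g k + z) (combination-++ cs ds k)) (sym (ℤ.+-assoc (c * g k) _ _))

scale : ∀ {m} → ℤ → List (ℤ × Form m) → List (ℤ × Form m)
scale c = map (λ (dg : ℤ × Form _) → c * proj₁ dg , proj₂ dg)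

combination-scale : ∀ {m} c (cs : List (ℤ × Form m)) k →
                    combination (scale c cs) k ≡ c * combination cs k
combination-scale c [] k = sym (ℤ.*-zeroʳ c)
combination-scale c ((d , g) ∷ cs) k =
  trans (cong (λ z → c * d * g k + z) (combination-scale c cs k)) (factor c d (g k) _)
  where
  factor : ∀ c d x y → c * d * x + c * y ≡ c * (d * x + y)
  factor = solve-∀

module _ {m p : ℕ} {S : Form m → Set} where

  span-resp : ∀ {v w} → v ≈[ p ] w → InSpan p S w → InSpan p S v
  span-resp {v} {w} v≈w (cs , gens , w≈cs) =
    cs , gens , ≈-pointwise (λ k → ≡-mod-trans (≈-at {v = v} v≈w k) (≈-at {v = w} w≈cs k))

  span-zero : InSpan p S zeroF
  span-zero = [] , [] , ≈-refl zeroF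

  span-gen : ∀ {g} → S g → InSpan p S g
  span-gen {g} Sg = (1ℤ , g) ∷ [] , Sg ∷ [] ,
    ≈-pointwise (λ k → ≡⇒≡-mod (sym (trans (ℤ.+-identityʳ _) (ℤ.*-identityˡ (g k)))))

  span-⊕ : ∀ {v w} → InSpan p S v → InSpan p S w → InSpan p S (v ⊕ w)
  span-⊕ {v} {w} (cs , gs , v≈cs) (ds , hs , w≈ds) =
    cs ++ ds , All.++⁺ gs hs ,
    ≈-pointwise (λ k → ≡-mod-trans (+-cong-mod (≈-at {v = v} v≈cs k) (≈-at {v = w} w≈ds k))
                                    (≡⇒≡-mod (sym (combination-++ cs ds k))))

  span-⊙ : ∀ c {v} → InSpan p S v → InSpan p S (c ⊙ v)
  span-⊙ c {v} (cs , gs , v≈cs) =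
    scale c cs , All.map⁺ gs ,
    ≈-pointwise (λ k → ≡-mod-trans (*-congˡ-mod c (≈-at {v = v} v≈cs k))
                                    (≡⇒≡-mod (sym (combination-scale c cs k))))

  span-sumForms : ∀ {vs} → All (InSpan p S) vs → InSpan p S (sumForms vs)
  span-sumForms [] = span-zero
  span-sumForms {v ∷ vs} (v∈ ∷ vs∈) = span-⊕ {v} {sumForms vs} v∈ (span-sumForms vs∈)

  span-combination : ∀ cs → All (InSpan p S ∘ proj₂) cs → InSpan p S (combination cs)
  span-combination cs gs = span-sumForms (All.map⁺ (All.map (λ {(c , g)} → span-⊙ c {g}) gs))

  span-span : ∀ {T : Form m → Set} → (∀ g → T g → InSpan p S g) →
              ∀ {v} → InSpan p T v → InSpan p S v
  span-span T⊆S {v} (cs , gs , v≈cs) =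
    span-resp {v} {combination cs} v≈cs (span-combination cs (All.map (λ {(_ , g)} → T⊆S g) gs))

span⊆sum : ∀ {m p} {S T : Form m → Set} {v} → InSpan p S v → InSum p (InSpan p S) (InSpan p T) v
span⊆sum {v = v} v∈S = v , zeroF , v∈S , span-zero ,
  ≈-pointwise {v = v} (λ k → ≡⇒≡-mod (sym (ℤ.+-identityʳ (v k))))

sum⊆span : ∀ {m p} {S T : Form m → Set} → (∀ g → T g → InSpan p S g) →
           ∀ {v} → InSum p (InSpan p S) (InSpan p T) v → InSpan p S v
sum⊆span T⊆S {v} (a , b , a∈S , b∈T , v≈a⊕b) =
  span-resp {v = v} {a ⊕ b} v≈a⊕b (span-⊕ {v = a} {b} a∈S (span-span T⊆S {b} b∈T))

-- Counting the subsets between two sets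

count : ∀ {A : Set} → (A → Bool) → List A → ℕ
count q [] = 0
count q (x ∷ xs) = if q x then suc (count q xs) else count q xs

count-++ : ∀ {A : Set} (q : A → Bool) xs ys → count q (xs ++ ys) ≡ count q xs ℕ.+ count q ys
count-++ q [] ys = refl
count-++ q (x ∷ xs) ys with q x
... | true = cong suc (count-++ q xs ys)
... | false = count-++ q xs ys

count-map : ∀ {A B : Set} (q : B → Bool) (f : A → B) xs → count q (map f xs) ≡ count (q ∘ f) xs
count-map q f [] = refl
count-map q f (x ∷ xs) with q (f x)
... | true = cong suc (count-map q f xs)
... | false = count-map q f xs

count-cong : ∀ {A : Set} {q r : A → Bool} → (∀ x → q x ≡ r x) → ∀ xs → count q xs ≡ count r xs
count-cong q≗r [] = refl
count-cong {q = q} {r} q≗r (x ∷ xs) rewrite q≗r x with r x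
... | true = cong suc (count-cong q≗r xs)
... | false = count-cong q≗r xs

count-none : ∀ {A : Set} {q : A → Bool} → (∀ x → ¬ T (q x)) → ∀ xs → count q xs ≡ 0
count-none none [] = refl
count-none {q = q} none (x ∷ xs) with q x | none x
... | true | qx-false = contradiction _ qx-false
... | false | _ = count-none none xs

slice : ∀ {n} → Subset n → Subset n → ℕ → Subset n → Bool
slice I Y c H = ⌊ H ⊆? Y ⌋ ∧ (∣ H ∣ ≡ᵇ c) ∧ ⌊ I ⊆? H ⌋

sliceCount : ∀ {n} → Subset n → Subset n → ℕ → ℕ
sliceCount {n} I Y c = count (slice I Y c) (allSubsets n)

slice-sound : ∀ {n} {I Y H : Subset n} {c} → T (slice I Y c H) → H ⊆ Y × ∣ H ∣ ≡ c × I ⊆ H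
slice-sound {I = I} {Y} {H} {c} t
  with H⊆Y , t′ ← Equivalence.to (T-∧ {⌊ H ⊆? Y ⌋}) t
  with ∣H∣≡c , I⊆H ← Equivalence.to (T-∧ {∣ H ∣ ≡ᵇ c}) t′
  = toWitness {a? = H ⊆? Y} H⊆Y , ℕ.≡ᵇ⇒≡ ∣ H ∣ c ∣H∣≡c , toWitness {a? = I ⊆? H} I⊆H

slice-none : ∀ {k n} {I Y : Subset n} {c} (f : Subset k → Subset n) →
             (∀ {H} → f H ⊆ Y → ∣ f H ∣ ≡ c → ¬ I ⊆ f H) →
             ∀ Hs → count (slice I Y c) (map f Hs) ≡ 0
slice-none {I = I} {Y} {c} f empty Hs = trans (count-map _ f Hs) (count-none none Hs)
  where
  none : ∀ H → ¬ T (slice I Y c (f H))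
  none H t = let fH⊆Y , ∣fH∣≡c , I⊆fH = slice-sound {I = I} {Y} {f H} {c} t
             in empty fH⊆Y ∣fH∣≡c I⊆fH

sliceCount-⊈ : ∀ {n} {I Y : Subset n} {c} → ¬ I ⊆ Y → sliceCount I Y c ≡ 0
sliceCount-⊈ {n} {I} {Y} {c} I⊈Y = count-none none (allSubsets n)
  where
  none : ∀ H → ¬ T (slice I Y c H)
  none H t = let H⊆Y , _ , I⊆H = slice-sound {I = I} {Y} {H} {c} t in I⊈Y (⊆-trans I⊆H H⊆Y)

⌊∷⊆?∷⌋ : ∀ {n} x y (H Y : Subset n) → ⌊ x ∷ H ⊆? y ∷ Y ⌋ ≡ (if x then y else true) ∧ ⌊ H ⊆? Y ⌋
⌊∷⊆?∷⌋ inside inside H Y = ⌊⌋-map′ _ _ (H ⊆? Y)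
⌊∷⊆?∷⌋ inside outside H Y = refl
⌊∷⊆?∷⌋ outside y H Y = ⌊⌋-map′ _ _ (H ⊆? Y)

withFirst withoutFirst : ∀ {n} → Subset (suc n) → Subset (suc n) → ℕ → ℕ
withFirst {n} I Y c = count (slice I Y c) (map (inside ∷_) (allSubsets n))
withoutFirst {n} I Y c = count (slice I Y c) (map (outside ∷_) (allSubsets n))

sliceCount-split : ∀ {n} (I Y : Subset (suc n)) c →
                   sliceCount I Y c ≡ withFirst I Y c ℕ.+ withoutFirst I Y c
sliceCount-split {n} I Y c = count-++ (slice I Y c) (map (inside ∷_) (allSubsets n)) _

withFirst-∷ : ∀ {n} x (I Y : Subset n) c → withFirst (x ∷ I) (inside ∷ Y) (suc c) ≡ sliceCount I Y c
withFirst-∷ {n} x I Y c =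
  trans (count-map _ (inside ∷_) (allSubsets n)) (count-cong (slice-inside x) (allSubsets n))
  where
  slice-inside : ∀ x H → slice (x ∷ I) (inside ∷ Y) (suc c) (inside ∷ H) ≡ slice I Y c H
  slice-inside inside H rewrite ⌊∷⊆?∷⌋ inside inside H Y | ⌊∷⊆?∷⌋ inside inside I H = refl
  slice-inside outside H rewrite ⌊∷⊆?∷⌋ inside inside H Y | ⌊∷⊆?∷⌋ outside inside I H = refl

withoutFirst-∷ : ∀ {n} y (I Y : Subset n) c → withoutFirst (outside ∷ I) (y ∷ Y) c ≡ sliceCount I Y c
withoutFirst-∷ {n} y I Y c =
  trans (count-map _ (outside ∷_) (allSubsets n)) (count-cong slice-outside (allSubsets n))
  where
  slice-outside : ∀ H → slice (outside ∷ I) (y ∷ Y) c (outside ∷ H) ≡ slice I Y c H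
  slice-outside H rewrite ⌊∷⊆?∷⌋ outside y H Y | ⌊∷⊆?∷⌋ outside outside I H = refl

withFirst-outside : ∀ {n} (I : Subset (suc n)) (Y : Subset n) c → withFirst I (outside ∷ Y) c ≡ 0
withFirst-outside {n} I Y c =
  slice-none (inside ∷_) (λ H⊆Y _ _ → case H⊆Y here of λ ()) (allSubsets n)

withoutFirst-inside : ∀ {n} (I : Subset n) (Y : Subset (suc n)) c → withoutFirst (inside ∷ I) Y c ≡ 0
withoutFirst-inside {n} I Y c =
  slice-none (outside ∷_) (λ _ _ I⊆H → case I⊆H here of λ ()) (allSubsets n)

withFirst-below : ∀ {n} (I : Subset n) (Y : Subset (suc n)) {c} →
                  c ≤ ∣ I ∣ → withFirst (outside ∷ I) Y c ≡ 0
withFirst-below {n} I Y {c} c≤∣I∣ = slice-none (inside ∷_) too-large (allSubsets n)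
  where
  too-large : ∀ {H} → inside ∷ H ⊆ Y → suc ∣ H ∣ ≡ c → ¬ outside ∷ I ⊆ inside ∷ H
  too-large _ refl I⊆H = ℕ.≤⇒≯ (p⊆q⇒∣p∣≤∣q∣ (drop-∷-⊆ I⊆H)) c≤∣I∣

sliceCount-binomial : ∀ {n} {I Y : Subset n} → I ⊆ Y →
                      ∀ j → sliceCount I Y (∣ I ∣ ℕ.+ j) ≡ (∣ Y ∣ ∸ ∣ I ∣) C j
sliceCount-binomial {zero} {[]} {[]} _ zero = refl
sliceCount-binomial {zero} {[]} {[]} _ (suc j) = refl
sliceCount-binomial {suc n} {inside ∷ I} {outside ∷ Y} I⊆Y j with I⊆Y here
... | ()
sliceCount-binomial {suc n} {inside ∷ I} {inside ∷ Y} I⊆Y j = begin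
  sliceCount (inside ∷ I) (inside ∷ Y) c
    ≡⟨ sliceCount-split (inside ∷ I) (inside ∷ Y) c ⟩
  withFirst (inside ∷ I) (inside ∷ Y) c ℕ.+ withoutFirst (inside ∷ I) (inside ∷ Y) c
    ≡⟨ cong₂ ℕ._+_ (withFirst-∷ inside I Y _) (withoutFirst-inside I (inside ∷ Y) c) ⟩
  sliceCount I Y (∣ I ∣ ℕ.+ j) ℕ.+ 0
    ≡⟨ ℕ.+-identityʳ _ ⟩
  sliceCount I Y (∣ I ∣ ℕ.+ j)
    ≡⟨ sliceCount-binomial (drop-∷-⊆ I⊆Y) j ⟩
  (∣ Y ∣ ∸ ∣ I ∣) C j ∎
  where
  open ≡-Reasoning
  c = suc ∣ I ∣ ℕ.+ j
sliceCount-binomial {suc n} {outside ∷ I} {outside ∷ Y} I⊆Y j = begin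
  sliceCount (outside ∷ I) (outside ∷ Y) c
    ≡⟨ sliceCount-split (outside ∷ I) (outside ∷ Y) c ⟩
  withFirst (outside ∷ I) (outside ∷ Y) c ℕ.+ withoutFirst (outside ∷ I) (outside ∷ Y) c
    ≡⟨ cong₂ ℕ._+_ (withFirst-outside (outside ∷ I) Y c) (withoutFirst-∷ outside I Y c) ⟩
  sliceCount I Y (∣ I ∣ ℕ.+ j)
    ≡⟨ sliceCount-binomial (drop-∷-⊆ I⊆Y) j ⟩
  (∣ Y ∣ ∸ ∣ I ∣) C j ∎
  where
  open ≡-Reasoning
  c = ∣ I ∣ ℕ.+ j
sliceCount-binomial {suc n} {outside ∷ I} {inside ∷ Y} I⊆Y zero = begin
  sliceCount (outside ∷ I) (inside ∷ Y) c
    ≡⟨ sliceCount-split (outside ∷ I) (inside ∷ Y) c ⟩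
  withFirst (outside ∷ I) (inside ∷ Y) c ℕ.+ withoutFirst (outside ∷ I) (inside ∷ Y) c
    ≡⟨ cong₂ ℕ._+_ (withFirst-below I (inside ∷ Y) (ℕ.≤-reflexive (ℕ.+-identityʳ _)))
                   (withoutFirst-∷ inside I Y c) ⟩
  sliceCount I Y (∣ I ∣ ℕ.+ 0)
    ≡⟨ sliceCount-binomial (drop-∷-⊆ I⊆Y) 0 ⟩
  1 ∎
  where
  open ≡-Reasoning
  c = ∣ I ∣ ℕ.+ 0
sliceCount-binomial {suc n} {outside ∷ I} {inside ∷ Y} I⊆Y (suc j) = begin
  sliceCount (outside ∷ I) (inside ∷ Y) c
    ≡⟨ sliceCount-split (outside ∷ I) (inside ∷ Y) c ⟩
  withFirst (outside ∷ I) (inside ∷ Y) c ℕ.+ withoutFirst (outside ∷ I) (inside ∷ Y) c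
    ≡⟨ cong₂ ℕ._+_ (trans (cong (withFirst (outside ∷ I) (inside ∷ Y)) (ℕ.+-suc ∣ I ∣ j))
                          (withFirst-∷ outside I Y _))
                   (withoutFirst-∷ inside I Y c) ⟩
  sliceCount I Y (∣ I ∣ ℕ.+ j) ℕ.+ sliceCount I Y (∣ I ∣ ℕ.+ suc j)
    ≡⟨ cong₂ ℕ._+_ (sliceCount-binomial I⊆Y′ j) (sliceCount-binomial I⊆Y′ (suc j)) ⟩
  (∣ Y ∣ ∸ ∣ I ∣) C j ℕ.+ (∣ Y ∣ ∸ ∣ I ∣) C suc j
    ≡⟨ nCk+nC[k+1]≡[n+1]C[k+1] (∣ Y ∣ ∸ ∣ I ∣) j ⟩
  suc (∣ Y ∣ ∸ ∣ I ∣) C suc j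
    ≡⟨ cong (_C suc j) (ℕ.+-∸-assoc 1 (p⊆q⇒∣p∣≤∣q∣ I⊆Y′)) ⟨
  (suc ∣ Y ∣ ∸ ∣ I ∣) C suc j ∎
  where
  open ≡-Reasoning
  c = ∣ I ∣ ℕ.+ suc j
  I⊆Y′ = drop-∷-⊆ I⊆Y

-- HighSum A i r I is sliceSum A I (Xset n) (i + 2 * r) by definition
sliceSum : ∀ {n m} → (Fin m → Subset n) → Subset n → Subset n → ℕ → Form m
sliceSum {n} A I Y c = sumForms (map (LForm A) (filterᵇ (slice I Y c) (allSubsets n)))

sumForms-LForm-filter : ∀ {n m} (A : Fin m → Subset n) (q : Subset n → Bool) Hs k →
  sumForms (map (LForm A) (filterᵇ q Hs)) k ≡ + count (λ H → q H ∧ ⌊ H ⊆? A k ⌋) Hs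
sumForms-LForm-filter A q [] k = refl
sumForms-LForm-filter A q (H ∷ Hs) k with q H
... | false = sumForms-LForm-filter A q Hs k
... | true with ⌊ H ⊆? A k ⌋
...   | true = cong (λ z → 1ℤ + z) (sumForms-LForm-filter A q Hs k)
...   | false = trans (ℤ.+-identityˡ _) (sumForms-LForm-filter A q Hs k)

⌊⊆?∩⌋ : ∀ {n} (H Y B : Subset n) → ⌊ H ⊆? Y ∩ B ⌋ ≡ ⌊ H ⊆? Y ⌋ ∧ ⌊ H ⊆? B ⌋
⌊⊆?∩⌋ H Y B = begin
  ⌊ H ⊆? Y ∩ B ⌋                       ≡⟨ isYes≗does (H ⊆? Y ∩ B) ⟩
  does (H ⊆? Y ∩ B)                    ≡⟨ does-⇔ ⊆∩⇔ (H ⊆? Y ∩ B) (H ⊆? Y ×-dec H ⊆? B) ⟩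
  does (H ⊆? Y) ∧ does (H ⊆? B)        ≡⟨ cong₂ _∧_ (isYes≗does (H ⊆? Y)) (isYes≗does (H ⊆? B)) ⟨
  ⌊ H ⊆? Y ⌋ ∧ ⌊ H ⊆? B ⌋              ∎
  where
  open ≡-Reasoning
  ⊆∩⇔ : H ⊆ Y ∩ B ⇔ (H ⊆ Y × H ⊆ B)
  ⊆∩⇔ = mk⇔ ⊆∩⁻ ⊆∩
    where
    ⊆∩⁻ : H ⊆ Y ∩ B → H ⊆ Y × H ⊆ B
    ⊆∩⁻ H⊆Y∩B = ⊆-trans H⊆Y∩B (p∩q⊆p Y B) , ⊆-trans H⊆Y∩B (p∩q⊆q Y B)
    ⊆∩ : H ⊆ Y × H ⊆ B → H ⊆ Y ∩ B
    ⊆∩ (H⊆Y , H⊆B) x∈H = x∈p∩q⁺ (H⊆Y x∈H , H⊆B x∈H)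

sliceSum-at : ∀ {n m} (A : Fin m → Subset n) I Y c k →
              sliceSum A I Y c k ≡ + sliceCount I (Y ∩ A k) c
sliceSum-at {n} A I Y c k =
  trans (sumForms-LForm-filter A (slice I Y c) (allSubsets n) k)
        (cong +_ (count-cong slice-∩ (allSubsets n)))
  where
  slice-∩ : ∀ H → slice I Y c H ∧ ⌊ H ⊆? A k ⌋ ≡ slice I (Y ∩ A k) c H
  slice-∩ H rewrite ⌊⊆?∩⌋ H Y (A k) with ⌊ H ⊆? Y ⌋ | ⌊ H ⊆? A k ⌋
  ... | true | true = ∧-identityʳ _
  ... | true | false = ∧-zeroʳ _
  ... | false | _ = refl

sliceSum-binomial : ∀ {n m} (A : Fin m → Subset n) {I Y} j k → I ⊆ Y ∩ A k →
                    sliceSum A I Y (∣ I ∣ ℕ.+ j) k ≡ + ((∣ Y ∩ A k ∣ ∸ ∣ I ∣) C j)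
sliceSum-binomial A {I} {Y} j k I⊆Y∩B =
  trans (sliceSum-at A I Y _ k) (cong +_ (sliceCount-binomial I⊆Y∩B j))

sliceSum-⊈ : ∀ {n m} (A : Fin m → Subset n) {I Y} c k → ¬ I ⊆ Y ∩ A k → sliceSum A I Y c k ≡ 0ℤ
sliceSum-⊈ A {I} {Y} c k I⊈Y∩B = trans (sliceSum-at A I Y c k) (cong +_ (sliceCount-⊈ I⊈Y∩B))

LForm∈span : ∀ {n m p} (A : Fin m → Subset n) {H i r} → H ⊆ Xset n →
             i ≤ ∣ H ∣ → ∣ H ∣ < i ℕ.+ 2 ℕ.* r → InSpan p (LowGen p A i r) (LForm A H)
LForm∈span A {H} H⊆X i≤∣H∣ ∣H∣<i+2r =
  span-gen {g = LForm A H} (H , (λ {x} → H⊆X {x}) , i≤∣H∣ , ∣H∣<i+2r , ≈-refl (LForm A H))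

sliceSum∈span : ∀ {n m p} (A : Fin m → Subset n) {I Y c i r} → Y ⊆ Xset n →
                i ≤ c → c < i ℕ.+ 2 ℕ.* r → InSpan p (LowGen p A i r) (sliceSum A I Y c)
sliceSum∈span {n} {m} {p} A {I} {Y} {c} {i} {r} Y⊆X i≤c c<i+2r =
  span-sumForms (All.map⁺ (All.map (λ {H} → generator H)
                                   (all-filter (T? ∘ slice I Y c) (allSubsets n))))
  where
  generator : ∀ H → T (slice I Y c H) → InSpan p (LowGen p A i r) (LForm A H)
  generator H t with H⊆Y , refl , _ ← slice-sound {I = I} {Y} {H} {c} t =
    LForm∈span A {r = r} (⊆-trans H⊆Y Y⊆X) i≤c c<i+2r

-- Binomial interpolation modulo p

n*nCk≡[k+1]*nC[k+1]+k*nCk : ∀ u N → u ℕ.* (u C N) ≡ suc N ℕ.* (u C suc N) ℕ.+ N ℕ.* (u C N)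
n*nCk≡[k+1]*nC[k+1]+k*nCk zero zero = refl
n*nCk≡[k+1]*nC[k+1]+k*nCk zero (suc N) = sym (cong₂ ℕ._+_ (ℕ.*-zeroʳ (suc (suc N))) (ℕ.*-zeroʳ (suc N)))
n*nCk≡[k+1]*nC[k+1]+k*nCk (suc u) zero rewrite nC1≡n (suc u) =
  trans (ℕ.*-identityʳ _) (sym (trans (ℕ.+-identityʳ _) (ℕ.*-identityˡ _)))
n*nCk≡[k+1]*nC[k+1]+k*nCk (suc u) (suc N) = begin
  suc u ℕ.* (suc u C suc N)
    ≡⟨ cong (suc u ℕ.*_) (nCk+nC[k+1]≡[n+1]C[k+1] u N) ⟨
  suc u ℕ.* (c₀ ℕ.+ c₁)
    ≡⟨ distribute u c₀ c₁ ⟩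
  c₀ ℕ.+ c₁ ℕ.+ (u ℕ.* c₀ ℕ.+ u ℕ.* c₁)
    ≡⟨ cong₂ (λ a b → c₀ ℕ.+ c₁ ℕ.+ (a ℕ.+ b))
             (n*nCk≡[k+1]*nC[k+1]+k*nCk u N) (n*nCk≡[k+1]*nC[k+1]+k*nCk u (suc N)) ⟩
  c₀ ℕ.+ c₁ ℕ.+ (suc N ℕ.* c₁ ℕ.+ N ℕ.* c₀ ℕ.+ (suc (suc N) ℕ.* c₂ ℕ.+ suc N ℕ.* c₁))
    ≡⟨ regroup N c₀ c₁ c₂ ⟩
  suc (suc N) ℕ.* (c₁ ℕ.+ c₂) ℕ.+ suc N ℕ.* (c₀ ℕ.+ c₁)
    ≡⟨ cong₂ (λ a b → suc (suc N) ℕ.* a ℕ.+ suc N ℕ.* b)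
             (nCk+nC[k+1]≡[n+1]C[k+1] u (suc N)) (nCk+nC[k+1]≡[n+1]C[k+1] u N) ⟩
  suc (suc N) ℕ.* (suc u C suc (suc N)) ℕ.+ suc N ℕ.* (suc u C suc N) ∎
  where
  open ≡-Reasoning
  c₀ = u C N
  c₁ = u C suc N
  c₂ = u C suc (suc N)
  distribute : ∀ u a b → suc u ℕ.* (a ℕ.+ b) ≡ a ℕ.+ b ℕ.+ (u ℕ.* a ℕ.+ u ℕ.* b)
  distribute = ℕ-solve-∀
  regroup : ∀ N a b c → a ℕ.+ b ℕ.+ (suc N ℕ.* b ℕ.+ N ℕ.* a ℕ.+ (suc (suc N) ℕ.* c ℕ.+ suc N ℕ.* b))
                        ≡ suc (suc N) ℕ.* (b ℕ.+ c) ℕ.+ suc N ℕ.* (a ℕ.+ b)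
  regroup = ℕ-solve-∀

[n-k]*nCk≡[k+1]*nC[k+1] : ∀ u N → (+ u - + N) * + (u C N) ≡ + suc N * + (u C suc N)
[n-k]*nCk≡[k+1]*nC[k+1] u N = begin
  (+ u - + N) * + c₀                           ≡⟨ distribute (+ u) (+ N) (+ c₀) ⟩
  + u * + c₀ - + N * + c₀                      ≡⟨ cong (_- + N * + c₀) lifted ⟩
  + suc N * + c₁ + + N * + c₀ - + N * + c₀     ≡⟨ cancel (+ suc N * + c₁) (+ N * + c₀) ⟩
  + suc N * + c₁                               ∎
  where
  open ≡-Reasoning
  c₀ = u C N
  c₁ = u C suc N
  distribute : ∀ u N c → (u - N) * c ≡ u * c - N * c
  distribute = solve-∀
  cancel : ∀ a b → a + b - b ≡ a
  cancel = solve-∀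
  lifted : + u * + c₀ ≡ + suc N * + c₁ + + N * + c₀
  lifted = begin
    + u * + c₀                       ≡⟨ ℤ.pos-* u c₀ ⟨
    + (u ℕ.* c₀)                     ≡⟨ cong +_ (n*nCk≡[k+1]*nC[k+1]+k*nCk u N) ⟩
    + (suc N ℕ.* c₁ ℕ.+ N ℕ.* c₀)    ≡⟨ ℤ.pos-+ (suc N ℕ.* c₁) (N ℕ.* c₀) ⟩
    + (suc N ℕ.* c₁) + + (N ℕ.* c₀)  ≡⟨ cong₂ _+_ (ℤ.pos-* (suc N) c₁) (ℤ.pos-* N c₀) ⟩
    + suc N * + c₁ + + N * + c₀      ∎

sumTo : ℕ → (ℕ → ℤ) → ℤ
sumTo zero f = 0ℤ
sumTo (suc N) f = sumTo N f + f N

sumTo-cong : ∀ N {f g : ℕ → ℤ} → (∀ j → f j ≡ g j) → sumTo N f ≡ sumTo N g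
sumTo-cong zero f≗g = refl
sumTo-cong (suc N) f≗g = cong₂ _+_ (sumTo-cong N f≗g) (f≗g N)

sumTo-*ˡ : ∀ N a (f : ℕ → ℤ) → sumTo N (λ j → a * f j) ≡ a * sumTo N f
sumTo-*ˡ zero a f = sym (ℤ.*-zeroʳ a)
sumTo-*ˡ (suc N) a f = trans (cong (_+ a * f N) (sumTo-*ˡ N a f)) (sym (ℤ.*-distribˡ-+ a _ _))

binomialSum : (ℕ → ℤ) → ℕ → ℕ → ℤ
binomialSum D N u = sumTo N (λ j → D j * + (u C j))

-- coefficients of (x - e) · Σⱼ Dⱼ (x choose j) in the binomial basis
timesLinear : ℤ → (ℕ → ℤ) → ℕ → ℤ
timesLinear e D zero = (0ℤ - e) * D 0
timesLinear e D (suc j) = (+ suc j - e) * D (suc j) + + suc j * D j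

binomialSum-timesLinear : ∀ e D u N →
  binomialSum (timesLinear e D) (suc N) u
    ≡ (+ u - e) * binomialSum D N u + (+ N - e) * D N * + (u C N)
binomialSum-timesLinear e D u zero = base (D 0) e (+ u)
  where
  base : ∀ d e u → 0ℤ + (0ℤ - e) * d * 1ℤ ≡ (u - e) * 0ℤ + (0ℤ - e) * d * 1ℤ
  base = solve-∀
binomialSum-timesLinear e D u (suc N) = begin
  binomialSum (timesLinear e D) (suc N) u + timesLinear e D (suc N) * C₁
    ≡⟨ cong (_+ timesLinear e D (suc N) * C₁) (binomialSum-timesLinear e D u N) ⟩
  (+ u - e) * S + (+ N - e) * D N * C₀ + ((+ suc N - e) * D (suc N) + + suc N * D N) * C₁
    ≡⟨ regroup (+ u) e S (D N) C₀ (D (suc N)) C₁ (+ N) (+ suc N) ⟩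
  (+ u - e) * S + (+ suc N - e) * D (suc N) * C₁ + D N * (+ suc N * C₁) + (+ N - e) * D N * C₀
    ≡⟨ cong (λ z → (+ u - e) * S + (+ suc N - e) * D (suc N) * C₁ + D N * z + (+ N - e) * D N * C₀)
            ([n-k]*nCk≡[k+1]*nC[k+1] u N) ⟨
  (+ u - e) * S + (+ suc N - e) * D (suc N) * C₁ + D N * ((+ u - + N) * C₀) + (+ N - e) * D N * C₀
    ≡⟨ collect (+ u) e S (D N) C₀ (D (suc N)) C₁ (+ N) (+ suc N) ⟩
  (+ u - e) * (S + D N * C₀) + (+ suc N - e) * D (suc N) * C₁ ∎
  where
  open ≡-Reasoning
  S = binomialSum D N u
  C₀ = + (u C N)
  C₁ = + (u C suc N)
  regroup : ∀ u e S d C d′ C′ N N′ →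
    (u - e) * S + (N - e) * d * C + ((N′ - e) * d′ + N′ * d) * C′
      ≡ (u - e) * S + (N′ - e) * d′ * C′ + d * (N′ * C′) + (N - e) * d * C
  regroup = solve-∀
  collect : ∀ u e S d C d′ C′ N N′ →
    (u - e) * S + (N′ - e) * d′ * C′ + d * ((u - N) * C) + (N - e) * d * C
      ≡ (u - e) * (S + d * C) + (N′ - e) * d′ * C′
  collect = solve-∀

rootProduct : List ℤ → ℤ → ℤ
rootProduct [] x = 1ℤ
rootProduct (e ∷ es) x = (x - e) * rootProduct es x

record BinomialExpansion (es : List ℤ) : Set where
  field
    coefficient : ℕ → ℤ
    leading : coefficient (length es) ≡ + (length es !)
    vanishing : ∀ j → length es < j → coefficient j ≡ 0ℤ
    expands : ∀ u → rootProduct es (+ u) ≡ binomialSum coefficient (suc (length es)) u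

binomialExpansion : ∀ es → BinomialExpansion es
binomialExpansion [] = record
  { coefficient = λ { zero → 1ℤ ; (suc _) → 0ℤ }
  ; leading = refl
  ; vanishing = λ { (suc j) _ → refl }
  ; expands = λ u → refl
  }
binomialExpansion (e ∷ es) = record
  { coefficient = timesLinear e D
  ; leading = leading′
  ; vanishing = vanishing′
  ; expands = expands′
  }
  where
  open BinomialExpansion (binomialExpansion es) renaming (coefficient to D)
  d = length es
  leading′ : timesLinear e D (suc d) ≡ + (suc d !)
  leading′ = begin
    (+ suc d - e) * D (suc d) + + suc d * D d
      ≡⟨ cong₂ (λ a b → (+ suc d - e) * a + + suc d * b) (vanishing (suc d) (ℕ.n<1+n d)) leading ⟩
    (+ suc d - e) * 0ℤ + + suc d * + (d !)
      ≡⟨ drop-zero (+ suc d - e) (+ suc d * + (d !)) ⟩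
    + suc d * + (d !)
      ≡⟨ ℤ.pos-* (suc d) (d !) ⟨
    + (suc d !) ∎
    where
    open ≡-Reasoning
    drop-zero : ∀ a b → a * 0ℤ + b ≡ b
    drop-zero = solve-∀
  vanishing′ : ∀ j → suc d < j → timesLinear e D j ≡ 0ℤ
  vanishing′ (suc j) (s≤s d<j) =
    trans (cong₂ (λ a b → (+ suc j - e) * a + + suc j * b)
                 (vanishing (suc j) (ℕ.m<n⇒m<1+n d<j)) (vanishing j d<j))
          (both-zero (+ suc j - e) (+ suc j))
    where
    both-zero : ∀ a b → a * 0ℤ + b * 0ℤ ≡ 0ℤ
    both-zero = solve-∀
  expands′ : ∀ u → rootProduct (e ∷ es) (+ u) ≡ binomialSum (timesLinear e D) (suc (suc d)) u
  expands′ u = sym (begin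
    binomialSum (timesLinear e D) (suc (suc d)) u
      ≡⟨ binomialSum-timesLinear e D u (suc d) ⟩
    (+ u - e) * binomialSum D (suc d) u + (+ suc d - e) * D (suc d) * + (u C suc d)
      ≡⟨ cong (λ z → (+ u - e) * binomialSum D (suc d) u + (+ suc d - e) * z * + (u C suc d))
              (vanishing (suc d) (ℕ.n<1+n d)) ⟩
    (+ u - e) * binomialSum D (suc d) u + (+ suc d - e) * 0ℤ * + (u C suc d)
      ≡⟨ drop-zero (+ u - e) _ (+ suc d - e) _ ⟩
    (+ u - e) * binomialSum D (suc d) u
      ≡⟨ cong ((+ u - e) *_) (expands u) ⟨
    (+ u - e) * rootProduct es (+ u) ∎)
    where
    open ≡-Reasoning
    drop-zero : ∀ a S b c → a * S + b * 0ℤ * c ≡ a * S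
    drop-zero = solve-∀

lift-1+*≡* : ∀ a b c d → 1 ℕ.+ a ℕ.* b ≡ c ℕ.* d → 1ℤ + + a * + b ≡ + c * + d
lift-1+*≡* a b c d eq = begin
  1ℤ + + a * + b      ≡⟨ cong (λ z → 1ℤ + z) (ℤ.pos-* a b) ⟨
  + (1 ℕ.+ a ℕ.* b)   ≡⟨ cong +_ eq ⟩
  + (c ℕ.* d)         ≡⟨ ℤ.pos-* c d ⟩
  + c * + d           ∎
  where open ≡-Reasoning

prime∤! : ∀ {p} → Prime p → ∀ {m} → m < p → p ∤ m !
prime∤! pp {zero} _ p∣1 = ℕ.nonTrivial⇒≢1 {{prime⇒nonTrivial pp}} (∣1⇒≡1 p∣1)
prime∤! pp {suc m} m<p p∣m! with euclidsLemma (suc m) (m !) pp p∣m!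
... | inj₁ p∣1+m = ℕ.<⇒≱ m<p (∣⇒≤ p∣1+m)
... | inj₂ p∣m! = prime∤! pp (ℕ.<-trans (ℕ.n<1+n m) m<p) p∣m!

prime⊥! : ∀ {p} → Prime p → ∀ {m} → m < p → Coprime p (m !)
prime⊥! pp m<p (d∣p , d∣m!) with prime⇒irreducible pp d∣p
... | inj₁ d≡1 = d≡1
... | inj₂ refl = contradiction d∣m! (prime∤! pp m<p)

bézout⇒inverse : ∀ {p M} → Bézout.Identity 1 p M → ∃[ w ] w * + M ≡ 1ℤ [mod p ]
bézout⇒inverse {p} {M} (Bézout.+- x y eq) =
  - + y , congruent (divides (- + x) (begin
    - + y * + M - 1ℤ   ≡⟨ rearrange (+ y) (+ M) ⟩
    - (1ℤ + + y * + M) ≡⟨ cong -_ (lift-1+*≡* y M x p eq) ⟩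
    - (+ x * + p)      ≡⟨ ℤ.neg-distribˡ-* (+ x) (+ p) ⟩
    - + x * + p        ∎))
  where
  open ≡-Reasoning
  rearrange : ∀ y M → - y * M - 1ℤ ≡ - (1ℤ + y * M)
  rearrange = solve-∀
bézout⇒inverse {p} {M} (Bézout.-+ x y eq) =
  + y , congruent (divides (+ x) (trans (cong (_- 1ℤ) (sym (lift-1+*≡* x p y M eq)))
                                        (cancel (+ x * + p))))
  where
  cancel : ∀ a → 1ℤ + a - 1ℤ ≡ a
  cancel = solve-∀

factorial-invertible : ∀ {p} → Prime p → ∀ {m} → m < p → ∃[ w ] w * + (m !) ≡ 1ℤ [mod p ]
factorial-invertible pp m<p = bézout⇒inverse (coprime-Bézout (prime⊥! pp m<p))

binomial-reduction : ∀ {p} → Prime p → (es : List ℤ) → length es < p →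
  ∃[ c ] ∀ u → + p ℤ∣.∣ rootProduct es (+ u) →
             + (u C length es) ≡ sumTo (length es) (λ j → c j * + (u C j)) [mod p ]
binomial-reduction {p} pp es d<p with factorial-invertible pp d<p
... | w , congruent p∣wd!-1 = c , λ u p∣P →
  congruent (subst (+ p ℤ∣.∣_) (sym (difference u))
                   (ℤ∣.∣m∣n⇒∣m-n (ℤ∣.∣n⇒∣m*n w p∣P) (ℤ∣.∣m⇒∣m*n (+ (u C d)) p∣wd!-1)))
  where
  open BinomialExpansion (binomialExpansion es) renaming (coefficient to D)
  d = length es
  c : ℕ → ℤ
  c j = - (w * D j)
  difference : ∀ u → + (u C d) - sumTo d (λ j → c j * + (u C j))
                     ≡ w * rootProduct es (+ u) - (w * + (d !) - 1ℤ) * + (u C d)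
  difference u = begin
    Cd - sumTo d (λ j → c j * + (u C j))
      ≡⟨ cong (λ z → Cd - z) (trans (sumTo-cong d (λ j → reassociate w (D j) (+ (u C j))))
                                    (sumTo-*ˡ d (- w) _)) ⟩
    Cd - (- w) * S
      ≡⟨ rearrange Cd w S (+ (d !)) ⟩
    w * (S + + (d !) * Cd) - (w * + (d !) - 1ℤ) * Cd
      ≡⟨ cong (λ z → w * (S + z * Cd) - (w * + (d !) - 1ℤ) * Cd) leading ⟨
    w * binomialSum D (suc d) u - (w * + (d !) - 1ℤ) * Cd
      ≡⟨ cong (λ z → w * z - (w * + (d !) - 1ℤ) * Cd) (expands u) ⟨
    w * rootProduct es (+ u) - (w * + (d !) - 1ℤ) * Cd ∎
    where
    open ≡-Reasoning
    Cd = + (u C d)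
    S = binomialSum D d u
    reassociate : ∀ w a b → - (w * a) * b ≡ - w * (a * b)
    reassociate = solve-∀
    rearrange : ∀ C w S F → C - (- w) * S ≡ w * (S + F * C) - (w * F - 1ℤ) * C
    rearrange = solve-∀

-- Residues of the set sizes as roots

lastBit : ∀ {n} → Subset n → ℕ
lastBit [] = 0
lastBit (b ∷ []) = if b then 1 else 0
lastBit (_ ∷ b ∷ B) = lastBit (b ∷ B)

lastBit≤1 : ∀ {n} (B : Subset n) → lastBit B ≤ 1
lastBit≤1 [] = z≤n
lastBit≤1 (inside ∷ []) = s≤s z≤n
lastBit≤1 (outside ∷ []) = z≤n
lastBit≤1 (_ ∷ b ∷ B) = lastBit≤1 (b ∷ B)

lastBit-∩ : ∀ {n} (A B : Subset n) → lastBit (A ∩ B) ≡ lastBit A ℕ.* lastBit B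
lastBit-∩ [] [] = refl
lastBit-∩ (inside ∷ []) (b ∷ []) = sym (ℕ.+-identityʳ _)
lastBit-∩ (outside ∷ []) (b ∷ []) = refl
lastBit-∩ (_ ∷ a ∷ A) (_ ∷ b ∷ B) = lastBit-∩ (a ∷ A) (b ∷ B)

Xset-suc : ∀ n → Xset (suc (suc n)) ≡ inside ∷ Xset (suc n)
Xset-suc n = cong (inside ∷_) (tabulate-cong λ j →
  trans (isYes≗does (suc (suc (toℕ j)) ℕ.≤? suc n)) (sym (isYes≗does (suc (toℕ j) ℕ.≤? n))))

∣∣≡∣Xset∩∣+lastBit : ∀ {n} (B : Subset n) → ∣ B ∣ ≡ ∣ Xset n ∩ B ∣ ℕ.+ lastBit B
∣∣≡∣Xset∩∣+lastBit [] = refl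
∣∣≡∣Xset∩∣+lastBit (inside ∷ []) = refl
∣∣≡∣Xset∩∣+lastBit (outside ∷ []) = refl
∣∣≡∣Xset∩∣+lastBit {suc (suc n)} (b ∷ c ∷ B) =
  trans (split b (∣∣≡∣Xset∩∣+lastBit (c ∷ B)))
        (cong (λ X → ∣ X ∩ (b ∷ c ∷ B) ∣ ℕ.+ lastBit (c ∷ B)) (sym (Xset-suc n)))
  where
  split : ∀ b → ∣ c ∷ B ∣ ≡ ∣ Xset (suc n) ∩ (c ∷ B) ∣ ℕ.+ lastBit (c ∷ B) →
          ∣ b ∷ c ∷ B ∣ ≡ ∣ (inside ∷ Xset (suc n)) ∩ (b ∷ c ∷ B) ∣ ℕ.+ lastBit (c ∷ B)
  split inside = cong suc
  split outside = id

members : ∀ {n} → Subset n → List ℕ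
members [] = []
members (inside ∷ K) = 0 ∷ map suc (members K)
members (outside ∷ K) = map suc (members K)

members-length : ∀ {n} (K : Subset n) → length (members K) ≡ ∣ K ∣
members-length [] = refl
members-length (inside ∷ K) = cong suc (trans (length-map suc (members K)) (members-length K))
members-length (outside ∷ K) = trans (length-map suc (members K)) (members-length K)

members-∈ : ∀ {n} {K : Subset n} {x} → x ∈ K → toℕ x ∈ˡ members K
members-∈ {K = inside ∷ K} here = here refl
members-∈ {K = inside ∷ K} (there x∈K) = there (∈-map⁺ suc (members-∈ x∈K))
members-∈ {K = outside ∷ K} (there x∈K) = ∈-map⁺ suc (members-∈ x∈K)

residue⇒≡-mod : ∀ {p} (pp : Prime p) {K a} → ResidueIn p pp K a →
                ∃[ k ] k ∈ K × + a ≡ + toℕ k [mod p ]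
residue⇒≡-mod {p} pp {a = a} (k , k∈K , k≡a%p) = k , k∈K , congruent (divides (+ (a / p)) a-k≡q*p)
  where
  instance _ = prime⇒nonZero pp
  a-k≡q*p : + a - + toℕ k ≡ + (a / p) * + p
  a-k≡q*p = begin
    + a - + toℕ k                      ≡⟨ cong (λ z → + z - + toℕ k) (m≡m%n+[m/n]*n a p) ⟩
    + (a % p ℕ.+ a / p ℕ.* p) - + toℕ k ≡⟨ cong (λ r → + (r ℕ.+ a / p ℕ.* p) - + toℕ k) k≡a%p ⟨
    + (toℕ k ℕ.+ a / p ℕ.* p) - + toℕ k ≡⟨ cong (_- + toℕ k) (ℤ.pos-+ (toℕ k) (a / p ℕ.* p)) ⟩
    + toℕ k + + (a / p ℕ.* p) - + toℕ k ≡⟨ cancel (+ toℕ k) (+ (a / p ℕ.* p)) ⟩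
    + (a / p ℕ.* p)                    ≡⟨ ℤ.pos-* (a / p) p ⟩
    + (a / p) * + p                    ∎
    where
    open ≡-Reasoning
    cancel : ∀ x y → x + y - x ≡ y
    cancel = solve-∀

residueRoots : ℕ → List ℕ → List ℤ
residueRoots i [] = []
residueRoots i (κ ∷ κs) = + κ - + i ∷ + κ - + i - 1ℤ ∷ residueRoots i κs

residueRoots-length : ∀ i κs → length (residueRoots i κs) ≡ 2 ℕ.* length κs
residueRoots-length i [] = refl
residueRoots-length i (κ ∷ κs) =
  trans (cong (λ l → suc (suc l)) (residueRoots-length i κs)) (double-suc (length κs))
  where
  double-suc : ∀ l → suc (suc (2 ℕ.* l)) ≡ 2 ℕ.* suc l
  double-suc = ℕ-solve-∀

residueRoots-∈ : ∀ i {κ κs} → κ ∈ˡ κs →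
                 (+ κ - + i) ∈ˡ residueRoots i κs × (+ κ - + i - 1ℤ) ∈ˡ residueRoots i κs
residueRoots-∈ i (here refl) = here refl , there (here refl)
residueRoots-∈ i (there κ∈κs) =
  let a , b = residueRoots-∈ i κ∈κs in there (there a) , there (there b)

rootProduct-divisible : ∀ {d x e es} → e ∈ˡ es → d ℤ∣.∣ x - e → d ℤ∣.∣ rootProduct es x
rootProduct-divisible {es = _ ∷ es} (here refl) d∣x-e = ℤ∣.∣m⇒∣m*n (rootProduct es _) d∣x-e
rootProduct-divisible {x = x} {es = e ∷ _} (there e∈es) d∣x-e =
  ℤ∣.∣n⇒∣m*n (x - e) (rootProduct-divisible e∈es d∣x-e)

residueRoots-root : ∀ {p} i {κ κs} u t → κ ∈ˡ κs → t ≤ 1 → + (u ℕ.+ i ℕ.+ t) ≡ + κ [mod p ] →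
                    + p ℤ∣.∣ rootProduct (residueRoots i κs) (+ u)
residueRoots-root {p} i {κ} {κs} u t κ∈κs t≤1 (congruent p∣) =
  root t t≤1 (subst (λ z → + p ℤ∣.∣ z - + κ) split p∣)
  where
  split : + (u ℕ.+ i ℕ.+ t) ≡ + u + + i + + t
  split = trans (ℤ.pos-+ (u ℕ.+ i) t) (cong (_+ + t) (ℤ.pos-+ u i))
  root : ∀ t → t ≤ 1 → + p ℤ∣.∣ + u + + i + + t - + κ →
         + p ℤ∣.∣ rootProduct (residueRoots i κs) (+ u)
  root zero _ p∣ =
    rootProduct-divisible (proj₁ (residueRoots-∈ i κ∈κs)) (subst (_ ℤ∣.∣_) (shift₀ (+ u) (+ i) (+ κ)) p∣)
    where
    shift₀ : ∀ u i κ → u + i + 0ℤ - κ ≡ u - (κ - i)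
    shift₀ = solve-∀
  root (suc zero) _ p∣ =
    rootProduct-divisible (proj₂ (residueRoots-∈ i κ∈κs)) (subst (_ ℤ∣.∣_) (shift₁ (+ u) (+ i) (+ κ)) p∣)
    where
    shift₁ : ∀ u i κ → u + i + 1ℤ - κ ≡ u - (κ - i - 1ℤ)
    shift₁ = solve-∀
  root (suc (suc _)) (s≤s ())

residue-root : ∀ {p} (pp : Prime p) {K : Subset p} {n} {B I : Subset n} →
               ResidueIn p pp K ∣ B ∣ → I ⊆ Xset n ∩ B →
               + p ℤ∣.∣ rootProduct (residueRoots ∣ I ∣ (members K)) (+ (∣ Xset n ∩ B ∣ ∸ ∣ I ∣))
residue-root pp {n = n} {B} {I} residue I⊆X∩B with k , k∈K , ∣B∣≡k ← residue⇒≡-mod pp residue =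
  residueRoots-root ∣ I ∣ u (lastBit B) (members-∈ k∈K) (lastBit≤1 B)
                    (≡-mod-trans (≡⇒≡-mod (cong +_ u+i+t≡∣B∣)) ∣B∣≡k)
  where
  u = ∣ Xset n ∩ B ∣ ∸ ∣ I ∣
  u+i+t≡∣B∣ : u ℕ.+ ∣ I ∣ ℕ.+ lastBit B ≡ ∣ B ∣
  u+i+t≡∣B∣ = trans (cong (ℕ._+ lastBit B) (ℕ.m∸n+n≡m (p⊆q⇒∣p∣≤∣q∣ I⊆X∩B)))
                    (sym (∣∣≡∣Xset∩∣+lastBit B))

-- The case 2r < p

sumTo-0 : ∀ N → sumTo N (λ _ → 0ℤ) ≡ 0ℤ
sumTo-0 zero = refl
sumTo-0 (suc N) = cong (_+ 0ℤ) (sumTo-0 N)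

span-sumTo : ∀ {m p} {S : Form m → Set} (c : ℕ → ℤ) (F : ℕ → Form m) N →
             (∀ j → j < N → InSpan p S (F j)) → InSpan p S (λ k → sumTo N (λ j → c j * F j k))
span-sumTo c F zero _ = span-zero
span-sumTo c F (suc N) F∈S =
  span-⊕ {v = λ k → sumTo N (λ j → c j * F j k)} {c N ⊙ F N}
         (span-sumTo c F N (λ j j<N → F∈S j (ℕ.m<n⇒m<1+n j<N)))
         (span-⊙ (c N) {F N} (F∈S N (ℕ.n<1+n N)))

highSum∈span : ∀ {p} (pp : Prime p) (K : Subset p) {n m} (A : Fin m → Subset n) →
               2 ℕ.* ∣ K ∣ < p → (∀ a → ResidueIn p pp K ∣ A a ∣) →
               ∀ {I} → I ⊆ Xset n → InSpan p (LowGen p A ∣ I ∣ ∣ K ∣) (HighSum A ∣ I ∣ ∣ K ∣ I)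
highSum∈span {p} pp K {n} {m} A 2r<p residues {I} I⊆X =
  span-resp {v = HighSum A i r I} {V} (≈-pointwise high≡V)
            (span-sumTo c (λ j → sliceSum A I X (i ℕ.+ j)) d λ j j<d →
               sliceSum∈span A {r = r} id (ℕ.m≤m+n i j) (ℕ.+-monoʳ-< i (subst (j <_) d≡2r j<d)))
  where
  i = ∣ I ∣
  r = ∣ K ∣
  X = Xset n
  es = residueRoots i (members K)
  d = length es
  d≡2r : d ≡ 2 ℕ.* r
  d≡2r = trans (residueRoots-length i (members K)) (cong (2 ℕ.*_) (members-length K))
  reduction : ∃[ c ] ∀ u → + p ℤ∣.∣ rootProduct es (+ u) →
                           + (u C d) ≡ sumTo d (λ j → c j * + (u C j)) [mod p ]
  reduction = binomial-reduction pp es (subst (_< p) (sym d≡2r) 2r<p)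
  c : ℕ → ℤ
  c = proj₁ reduction
  V : Form m
  V k = sumTo d (λ j → c j * sliceSum A I X (i ℕ.+ j) k)
  high≡slice : ∀ k → HighSum A i r I k ≡ sliceSum A I X (i ℕ.+ d) k
  high≡slice k = cong (λ e → sliceSum A I X (i ℕ.+ e) k) (sym d≡2r)
  high≡V : ∀ k → HighSum A i r I k ≡ V k [mod p ]
  high≡V k with I ⊆? X ∩ A k
  ... | yes I⊆X∩B = begin
    HighSum A i r I k
      ≡⟨ trans (high≡slice k) (sliceSum-binomial A d k I⊆X∩B) ⟩
    + (u C d)
      ≈⟨ proj₂ reduction u (residue-root pp (residues k) I⊆X∩B) ⟩
    sumTo d (λ j → c j * + (u C j))
      ≡⟨ sumTo-cong d (λ j → cong (c j *_) (sliceSum-binomial A j k I⊆X∩B)) ⟨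
    V k ∎
    where
    open ≈-Reasoning (≡-mod-setoid p)
    u = ∣ X ∩ A k ∣ ∸ i
  ... | no I⊈X∩B = ≡⇒≡-mod (trans (trans (high≡slice k) (sliceSum-⊈ A _ k I⊈X∩B)) (sym V≡0))
    where
    V≡0 : V k ≡ 0ℤ
    V≡0 = trans (sumTo-cong d (λ j → trans (cong (c j *_) (sliceSum-⊈ A _ k I⊈X∩B)) (ℤ.*-zeroʳ (c j))))
                (sumTo-0 d)

-- The case p = 2

δ : ∀ {m} → Fin m → Fin m → ℤ
δ zero zero = 1ℤ
δ zero (suc _) = 0ℤ
δ (suc _) zero = 0ℤ
δ (suc a) (suc b) = δ a b

δ-refl : ∀ {m} (a : Fin m) → δ a a ≡ 1ℤ
δ-refl zero = refl
δ-refl (suc a) = δ-refl a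

δ-≢ : ∀ {m} {a b : Fin m} → a ≢ b → δ a b ≡ 0ℤ
δ-≢ {a = zero} {zero} a≢b = contradiction refl a≢b
δ-≢ {a = zero} {suc b} _ = refl
δ-≢ {a = suc a} {zero} _ = refl
δ-≢ {a = suc a} {suc b} a≢b = δ-≢ (a≢b ∘ cong suc)

sum-δ : ∀ {m} (v : Fin m → ℤ) b → sum (λ a → v a * δ a b) ≡ v b
sum-δ v zero = begin
  v zero * 1ℤ + sum (λ a → v (suc a) * 0ℤ)
    ≡⟨ cong₂ _+_ (ℤ.*-identityʳ (v zero)) (sum-0 (λ a → v (suc a))) ⟩
  v zero + 0ℤ
    ≡⟨ ℤ.+-identityʳ (v zero) ⟩
  v zero ∎
  where
  open ≡-Reasoning
  sum-0 : ∀ {t} (f : Fin t → ℤ) → sum (λ a → f a * 0ℤ) ≡ 0ℤ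
  sum-0 {zero} f = refl
  sum-0 {suc t} f = trans (cong₂ _+_ (ℤ.*-zeroʳ (f zero)) (sum-0 (f ∘ suc))) refl
sum-δ v (suc b) = trans (cong₂ _+_ (ℤ.*-zeroʳ (v zero)) (sum-δ (v ∘ suc) b)) (ℤ.+-identityˡ _)

sum-cong-mod : ∀ {p t} {f g : Fin t → ℤ} → (∀ a → f a ≡ g a [mod p ]) → sum f ≡ sum g [mod p ]
sum-cong-mod {t = zero} f≡g = ≡⇒≡-mod refl
sum-cong-mod {t = suc t} f≡g = +-cong-mod (f≡g zero) (sum-cong-mod (f≡g ∘ suc))

span-sum : ∀ {m p} {S : Form m → Set} {t} (F : Fin t → Form m) →
           (∀ a → InSpan p S (F a)) → InSpan p S (λ k → sum (λ a → F a k))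
span-sum {t = zero} F F∈S = span-zero
span-sum {t = suc t} F F∈S =
  span-⊕ {v = F zero} {λ k → sum (λ a → F (suc a) k)} (F∈S zero) (span-sum (F ∘ suc) (F∈S ∘ suc))

span-everything : ∀ {m p} {S : Form m → Set} (E : Fin m → Form m) →
                  (∀ a → InSpan p S (E a)) → (∀ a b → E a b ≡ δ a b [mod p ]) → ∀ v → InSpan p S v
span-everything {p = p} E E∈S E≡δ v =
  span-resp {v = v} {λ b → sum (λ a → v a * E a b)} (≈-pointwise v≡combination)
            (span-sum (λ a → v a ⊙ E a) (λ a → span-⊙ (v a) {E a} (E∈S a)))
  where
  v≡combination : ∀ b → v b ≡ sum (λ a → v a * E a b) [mod p ]
  v≡combination b = ≡-mod-trans (≡⇒≡-mod (sym (sum-δ v b)))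
                                (sum-cong-mod (λ a → *-congˡ-mod (v a) (≡-mod-sym (E≡δ a b))))

sliceSum-⊥ : ∀ {n m} (A : Fin m → Subset n) Y j k → sliceSum A ⊥ Y j k ≡ + (∣ Y ∩ A k ∣ C j)
sliceSum-⊥ {n} A Y j k =
  subst (λ z → sliceSum A ⊥ Y (z ℕ.+ j) k ≡ + ((∣ Y ∩ A k ∣ ∸ z) C j)) (∣⊥∣≡0 n)
        (sliceSum-binomial A j k ⊥⊆)

span-everything-p2 : ∀ {n m} (A : Fin m → Subset n) k₀ →
  (∀ a → + ∣ A a ∣ ≡ + k₀ [mod 2 ]) → (∀ a b → a ≢ b → + ∣ A a ∩ A b ∣ + + k₀ ≡ 1ℤ [mod 2 ]) →
  ∀ v → InSpan 2 (LowGen 2 A 0 1) v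
span-everything-p2 {n} {m} A k₀ ∣A∣≡k₀ ∣A∩A∣≡1-k₀ = span-everything E E∈span E≡δ
  where
  X = Xset n
  t : Fin m → ℤ
  t a = + lastBit (A a)
  singletons : Subset n → Form m
  singletons Y = sliceSum A ⊥ Y 1
  constant : Form m
  constant = sliceSum A ⊥ X 0
  α : Fin m → ℤ
  α a = t a * + k₀ - (1ℤ - + k₀)
  E : Fin m → Form m
  E a = singletons (X ∩ A a) ⊕ ((α a ⊙ constant) ⊕ ((- t a) ⊙ singletons X))

  E∈span : ∀ a → InSpan 2 (LowGen 2 A 0 1) (E a)
  E∈span a =
    span-⊕ {v = singletons (X ∩ A a)} (sliceSum∈span A {r = 1} (p∩q⊆p X (A a)) z≤n (s≤s (s≤s z≤n)))
      (span-⊕ {v = α a ⊙ constant}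
              (span-⊙ (α a) {constant} (sliceSum∈span A {r = 1} id z≤n (s≤s z≤n)))
              (span-⊙ (- t a) {singletons X} (sliceSum∈span A {r = 1} id z≤n (s≤s (s≤s z≤n)))))

  ∣∣-split : ∀ B → + ∣ B ∣ ≡ + ∣ X ∩ B ∣ + + lastBit B
  ∣∣-split B = trans (cong +_ (∣∣≡∣Xset∩∣+lastBit B)) (ℤ.pos-+ ∣ X ∩ B ∣ (lastBit B))

  ∣∩∣-split : ∀ a b → + ∣ A a ∩ A b ∣ ≡ + ∣ (X ∩ A a) ∩ A b ∣ + t a * t b
  ∣∩∣-split a b = begin
    + ∣ A a ∩ A b ∣
      ≡⟨ ∣∣-split (A a ∩ A b) ⟩
    + ∣ X ∩ (A a ∩ A b) ∣ + + lastBit (A a ∩ A b)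
      ≡⟨ cong₂ (λ B l → + ∣ B ∣ + + l) (sym (∩-assoc X (A a) (A b))) (lastBit-∩ (A a) (A b)) ⟩
    + ∣ (X ∩ A a) ∩ A b ∣ + + (lastBit (A a) ℕ.* lastBit (A b))
      ≡⟨ cong (λ z → + ∣ (X ∩ A a) ∩ A b ∣ + z) (ℤ.pos-* (lastBit (A a)) (lastBit (A b))) ⟩
    + ∣ (X ∩ A a) ∩ A b ∣ + t a * t b ∎
    where open ≡-Reasoning

  E-value : ∀ a b → E a b ≡ (+ ∣ A a ∩ A b ∣ + + k₀ - 1ℤ) - t a * (+ ∣ A b ∣ - + k₀)
  E-value a b = begin
    E a b
      ≡⟨ cong₂ (λ x y → x + (α a * y + (- t a) * singletons X b))
               (sliceSum-⊥ A (X ∩ A a) 1 b) (sliceSum-⊥ A X 0 b) ⟩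
    + (∣ (X ∩ A a) ∩ A b ∣ C 1) + (α a * 1ℤ + (- t a) * singletons X b)
      ≡⟨ cong₂ (λ x y → + x + (α a * 1ℤ + (- t a) * y))
               (nC1≡n _) (trans (sliceSum-⊥ A X 1 b) (cong +_ (nC1≡n _))) ⟩
    + ∣ (X ∩ A a) ∩ A b ∣ + (α a * 1ℤ + (- t a) * + ∣ X ∩ A b ∣)
      ≡⟨ regroup (+ ∣ (X ∩ A a) ∩ A b ∣) (+ ∣ X ∩ A b ∣) (t a) (t b) (+ k₀) ⟩
    (+ ∣ (X ∩ A a) ∩ A b ∣ + t a * t b + + k₀ - 1ℤ) - t a * (+ ∣ X ∩ A b ∣ + t b - + k₀)
      ≡⟨ cong₂ (λ x y → (x + + k₀ - 1ℤ) - t a * (y - + k₀)) (∣∩∣-split a b) (∣∣-split (A b)) ⟨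
    (+ ∣ A a ∩ A b ∣ + + k₀ - 1ℤ) - t a * (+ ∣ A b ∣ - + k₀) ∎
    where
    open ≡-Reasoning
    regroup : ∀ x y ta tb k → x + ((ta * k - (1ℤ - k)) * 1ℤ + (- ta) * y)
                              ≡ (x + ta * tb + k - 1ℤ) - ta * (y + tb - k)
    regroup = solve-∀

  E≡δ : ∀ a b → E a b ≡ δ a b [mod 2 ]
  E≡δ a b with a ≟ b
  ... | yes refl = congruent (subst (+ 2 ℤ∣.∣_) (sym E-1≡) 2∣)
    where
    s = + ∣ A a ∣
    2∣s-k₀ = p∣x-y (∣A∣≡k₀ a)
    2∣ : + 2 ℤ∣.∣ ((s - + k₀) - t a * (s - + k₀)) + (+ k₀ - 1ℤ) * + 2
    2∣ = ℤ∣.∣m∣n⇒∣m+n (ℤ∣.∣m∣n⇒∣m-n 2∣s-k₀ (ℤ∣.∣n⇒∣m*n (t a) 2∣s-k₀)) (divides (+ k₀ - 1ℤ) refl)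
    E-1≡ : E a a - δ a a ≡ ((s - + k₀) - t a * (s - + k₀)) + (+ k₀ - 1ℤ) * + 2
    E-1≡ = begin
      E a a - δ a a
        ≡⟨ cong₂ _-_ (E-value a a) (δ-refl a) ⟩
      (+ ∣ A a ∩ A a ∣ + + k₀ - 1ℤ) - t a * (s - + k₀) - 1ℤ
        ≡⟨ cong (λ B → (+ ∣ B ∣ + + k₀ - 1ℤ) - t a * (s - + k₀) - 1ℤ) (∩-idem (A a)) ⟩
      (s + + k₀ - 1ℤ) - t a * (s - + k₀) - 1ℤ
        ≡⟨ regroup s (+ k₀) (t a) ⟩
      ((s - + k₀) - t a * (s - + k₀)) + (+ k₀ - 1ℤ) * + 2 ∎
      where
      open ≡-Reasoning
      regroup : ∀ s k t → (s + k - 1ℤ) - t * (s - k) - 1ℤ ≡ ((s - k) - t * (s - k)) + (k - 1ℤ) * + 2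
      regroup = solve-∀
  ... | no a≢b = congruent (subst (+ 2 ℤ∣.∣_) (sym E-0≡) 2∣)
    where
    2∣ : + 2 ℤ∣.∣ (+ ∣ A a ∩ A b ∣ + + k₀ - 1ℤ) - t a * (+ ∣ A b ∣ - + k₀)
    2∣ = ℤ∣.∣m∣n⇒∣m-n (p∣x-y (∣A∩A∣≡1-k₀ a b a≢b)) (ℤ∣.∣n⇒∣m*n (t a) (p∣x-y (∣A∣≡k₀ b)))
    E-0≡ : E a b - δ a b ≡ (+ ∣ A a ∩ A b ∣ + + k₀ - 1ℤ) - t a * (+ ∣ A b ∣ - + k₀)
    E-0≡ = trans (cong₂ _-_ (E-value a b) (δ-≢ a≢b)) (ℤ.+-identityʳ _)

disjoint⇒∣∣+∣∣≤ : ∀ {p} {K L : Subset p} → Empty (K ∩ L) → ∣ K ∣ ℕ.+ ∣ L ∣ ≤ p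
disjoint⇒∣∣+∣∣≤ {p} {K} {L} K∩L=∅ = begin
  ∣ K ∣ ℕ.+ ∣ L ∣          ≤⟨ ℕ.+-monoʳ-≤ ∣ K ∣ (p⊆q⇒∣p∣≤∣q∣ L⊆∁K) ⟩
  ∣ K ∣ ℕ.+ ∣ ∁ K ∣        ≡⟨ cong (∣ K ∣ ℕ.+_) (∣∁p∣≡n∸∣p∣ K) ⟩
  ∣ K ∣ ℕ.+ (p ∸ ∣ K ∣)    ≡⟨ ℕ.m+[n∸m]≡n (∣p∣≤n K) ⟩
  p                        ∎
  where
  open ℕ.≤-Reasoning
  L⊆∁K : L ⊆ ∁ K
  L⊆∁K x∈L = x∉p⇒x∈∁p (λ x∈K → K∩L=∅ (_ , x∈p∩q⁺ (x∈K , x∈L)))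

degenerate-parameters : ∀ {p r s i} → 2 ≤ p → r ℕ.+ s ≤ p → i ℕ.+ 2 ℕ.* r ≤ s ℕ.+ 1 → p ≤ 2 ℕ.* r →
                        p ≡ 2 × r ≡ 1 × i ≡ 0
degenerate-parameters {p} {r} {s} {i} 2≤p r+s≤p i+2r≤s+1 p≤2r = shape i r i+r≤1 p≤2r
  where
  i+r≤1 : i ℕ.+ r ≤ 1
  i+r≤1 = ℕ.+-cancelʳ-≤ (s ℕ.+ 2 ℕ.* r) (i ℕ.+ r) 1 (begin
    i ℕ.+ r ℕ.+ (s ℕ.+ 2 ℕ.* r)    ≡⟨ regroup i r s ⟩
    i ℕ.+ 2 ℕ.* r ℕ.+ (r ℕ.+ s)    ≤⟨ ℕ.+-mono-≤ i+2r≤s+1 (ℕ.≤-trans r+s≤p p≤2r) ⟩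
    s ℕ.+ 1 ℕ.+ 2 ℕ.* r            ≡⟨ ℕ.+-comm (s ℕ.+ 1) (2 ℕ.* r) ⟩
    2 ℕ.* r ℕ.+ (s ℕ.+ 1)          ≡⟨ shuffle r s ⟩
    1 ℕ.+ (s ℕ.+ 2 ℕ.* r)          ∎)
    where
    open ℕ.≤-Reasoning
    regroup : ∀ i r s → i ℕ.+ r ℕ.+ (s ℕ.+ 2 ℕ.* r) ≡ i ℕ.+ 2 ℕ.* r ℕ.+ (r ℕ.+ s)
    regroup = ℕ-solve-∀
    shuffle : ∀ r s → 2 ℕ.* r ℕ.+ (s ℕ.+ 1) ≡ 1 ℕ.+ (s ℕ.+ 2 ℕ.* r)
    shuffle = ℕ-solve-∀
  shape : ∀ i r → i ℕ.+ r ≤ 1 → p ≤ 2 ℕ.* r → p ≡ 2 × r ≡ 1 × i ≡ 0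
  shape i zero _ p≤0 = contradiction (ℕ.≤-trans 2≤p p≤0) λ ()
  shape zero (suc zero) _ p≤2 = ℕ.≤-antisym p≤2 2≤p , refl , refl
  shape zero (suc (suc _)) (s≤s ()) _
  shape (suc i) (suc r) (s≤s i+1+r≤0) _ = contradiction (subst (_≤ 0) (ℕ.+-suc i r) i+1+r≤0) λ ()

two-residues : (K L : Subset 2) → Empty (K ∩ L) → ∣ K ∣ ≡ 1 →
               ∃[ k₀ ] (∀ {x} → x ∈ K → toℕ x ≡ k₀) × (∀ {y} → y ∈ L → toℕ y ℕ.+ k₀ ≡ 1)
two-residues (inside ∷ outside ∷ []) L K∩L=∅ _ = 0 , in-K , in-L
  where
  in-K : ∀ {x} → x ∈ inside ∷ outside ∷ [] → toℕ x ≡ 0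
  in-K here = refl
  in-K (there (there ()))
  in-L : ∀ {y} → y ∈ L → toℕ y ℕ.+ 0 ≡ 1
  in-L {zero} 0∈L = contradiction (zero , x∈p∩q⁺ (here , 0∈L)) K∩L=∅
  in-L {suc zero} _ = refl
two-residues (outside ∷ inside ∷ []) L K∩L=∅ _ = 1 , in-K , in-L
  where
  in-K : ∀ {x} → x ∈ outside ∷ inside ∷ [] → toℕ x ≡ 1
  in-K (there here) = refl
  in-L : ∀ {y} → y ∈ L → toℕ y ℕ.+ 1 ≡ 1
  in-L {zero} _ = refl
  in-L {suc zero} 1∈L = contradiction (suc zero , x∈p∩q⁺ (there here , 1∈L)) K∩L=∅
two-residues (inside ∷ inside ∷ []) L _ ()
two-residues (outside ∷ outside ∷ []) L _ ()

span-everything-degenerate : ∀ {p} (pp : Prime p) (K L : Subset p) → Empty (K ∩ L) →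
  ∀ {n m} (A : Fin m → Subset n) → (∀ a → ResidueIn p pp K ∣ A a ∣) →
  (∀ a b → a ≢ b → ResidueIn p pp L ∣ A a ∩ A b ∣) →
  ∀ {i} → i ℕ.+ 2 ℕ.* ∣ K ∣ ≤ ∣ L ∣ ℕ.+ 1 → p ≤ 2 ℕ.* ∣ K ∣ → ∀ v → InSpan p (LowGen p A i ∣ K ∣) v
span-everything-degenerate {p} pp K L K∩L=∅ A K-residues L-residues {i} i+2r≤s+1 p≤2r v
  with degenerate-parameters {i = i} (ℕ.nonTrivial⇒n>1 p {{prime⇒nonTrivial pp}})
                            (disjoint⇒∣∣+∣∣≤ K∩L=∅) i+2r≤s+1 p≤2r
... | refl , r≡1 , refl with k₀ , in-K , in-L ← two-residues K L K∩L=∅ r≡1 =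
  subst (λ r → InSpan 2 (LowGen 2 A 0 r) v) (sym r≡1) (span-everything-p2 A k₀ ∣A∣≡k₀ ∣A∩A∣≡1-k₀ v)
  where
  ∣A∣≡k₀ : ∀ a → + ∣ A a ∣ ≡ + k₀ [mod 2 ]
  ∣A∣≡k₀ a with k , k∈K , ∣A∣≡k ← residue⇒≡-mod pp (K-residues a) =
    ≡-mod-trans ∣A∣≡k (≡⇒≡-mod (cong +_ (in-K k∈K)))
  ∣A∩A∣≡1-k₀ : ∀ a b → a ≢ b → + ∣ A a ∩ A b ∣ + + k₀ ≡ 1ℤ [mod 2 ]
  ∣A∩A∣≡1-k₀ a b a≢b with l , l∈L , ∣A∩A∣≡l ← residue⇒≡-mod pp (L-residues a b a≢b) =
    ≡-mod-trans (+-cong-mod ∣A∩A∣≡l (≡⇒≡-mod {x = + k₀} refl))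
                (≡⇒≡-mod (trans (sym (ℤ.pos-+ (toℕ l) k₀)) (cong +_ (in-L l∈L))))

corollary2p3 : (p : ℕ) (pp : Prime p) (K L : Subset p) → Empty (K ∩ L) →
               (n m : ℕ) (A : Fin m → Subset n) →
               (∀ a → ResidueIn p pp K ∣ A a ∣) →
               (∀ a b → a ≢ b → ResidueIn p pp L ∣ A a ∩ A b ∣) →
               (i : ℕ) → i ℕ.+ 2 ℕ.* ∣ K ∣ ≤ ∣ L ∣ ℕ.+ 1 →
               ∀ v →
                 (InSpan p (LowGen p A i ∣ K ∣) v →
                    InSum p (InSpan p (LowGen p A i ∣ K ∣)) (InSpan p (HighGen p A i ∣ K ∣)) v)
                 × (InSum p (InSpan p (LowGen p A i ∣ K ∣)) (InSpan p (HighGen p A i ∣ K ∣)) v →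
                    InSpan p (LowGen p A i ∣ K ∣) v)
corollary2p3 p pp K L K∩L=∅ n m A K-residues L-residues i i+2r≤s+1 v =
  span⊆sum {T = HighGen p A i ∣ K ∣} {v} , sum⊆span high∈span {v}
  where
  high∈span : ∀ g → HighGen p A i ∣ K ∣ g → InSpan p (LowGen p A i ∣ K ∣) g
  high∈span g (I , I⊆X , refl , g≈high) with 2 ℕ.* ∣ K ∣ ℕ.<? p
  ... | yes 2r<p =
    span-resp {v = g} {HighSum A i ∣ K ∣ I} g≈high (highSum∈span pp K A 2r<p K-residues I⊆X)
  ... | no 2r≮p =
    span-everything-degenerate pp K L K∩L=∅ A K-residues L-residues i+2r≤s+1 (ℕ.≮⇒≥ 2r≮p) g
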